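{- Let $n>2$ be an integer and let $p>3$ be a prime with $2n-1\leqslant p\leqslant 2.4n$. For $d\in\{4,6,12\}$, the numbers $(2k-1)^d$ with $k=1,\ldots,n$ are pairwise distinct modulo $p$ if and only if $p\equiv -1\pmod d$. -}

module Defs where

open import Data.Nat using (ℕ; suc; _+_; _*_; _∸_; _^_; _≤_; _%_)
open import Relation.Binary.PropositionalEquality using (_≡_; _≢_)

PairwiseDistinctMod : (n d p : ℕ) → .{{_ : Data.Nat.NonZero p}} → Set
PairwiseDistinctMod n d p =
  ∀ j k → 1 ≤ j → j ≤ n → 1 ≤ k → k ≤ n → j ≢ k →
    ((2 * j ∸ 1) ^ d) % p ≢ ((2 * k ∸ 1) ^ d) % p

module Submission where

-- Lemma 4.2: for n > 2, a prime p > 3 with 2n - 1 ≤ p ≤ 2.4n and d ∈ {4, 6, 12},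
-- the powers (2k - 1)ᵈ (1 ≤ k ≤ n) are distinct modulo p iff d ∣ p + 1.
-- Write odd i = 2i + 1; the numbers are odd 0, …, odd (n - 1).
-- (⇐) If p + 1 = qd, then xᵈ ≡ yᵈ gives xᵖ⁺¹ ≡ yᵖ⁺¹, i.e. x² ≡ y² (Fermat),
--     but distinct odd numbers in [1, p] have distinct squares modulo p.
-- (⇒) As p ≡ ±1 modulo 4 and modulo 3, d ∤ p + 1 gives 4 ∣ p - 1 or 3 ∣ p - 1,
--     hence ζ with ζᵈ ≡ 1, ζ² ≢ 1.  Each ζ·(odd i) is ± some odd t < p with the
--     same d-th power, so distinctness forces t ≥ n; as p < 3n, two of
--     odd 0, …, odd (n - 2) land on the same t, so (odd i)² ≡ (odd j)²: absurd.
-- Roots of unity come from power sums: Sₖ = 0ᵏ + ⋯ + (p - 1)ᵏ ≡ 0 for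
-- k < p - 1 (binomial theorem), while all units being k-th roots of 1 would
-- give Sₖ ≡ -1.  The file develops congruences modulo p, sums and the binomial
-- theorem, Fermat's theorem and power sums modulo a prime, squares of odd
-- numbers with both directions, roots of unity of order 4 and 3, and the theorem.

open import Data.Empty using (⊥; ⊥-elim)
open import Data.Fin as Fin using (Fin; toℕ; fromℕ; fromℕ<; inject₁)
open import Data.Fin.Properties using (toℕ-fromℕ; toℕ-inject₁; toℕ-fromℕ<; toℕ<n; pigeonhole; ¬∀⟶∃¬)
open import Data.Nat
open import Data.Nat.Combinatorics using (_C_; nCn≡1; nC1≡n; nCk≡nC[n∸k]; nCk≡n!/k![n-k]!; k![n∸k]!∣n!)
open import Data.Nat.Divisibility
open import Data.Nat.DivMod
open import Data.Nat.Induction using (<-rec)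
open import Data.Nat.LCM using (lcm-least)
open import Data.Nat.Primality using (Prime; euclidsLemma; composite; prime⇒nonTrivial)
open import Data.Nat.Properties
open import Data.Nat.Tactic.RingSolver using (solve-∀)
open import Data.Product using (∃; ∃₂; _×_; _,_; proj₁; proj₂)
open import Data.Sum using (_⊎_; inj₁; inj₂)
open import Defs
open import Function using (_∘_)
open import Function.Bundles using (_⇔_; mk⇔)
open import Level using (0ℓ)
open import Relation.Binary using (Setoid; IsEquivalence; tri<; tri≈; tri>)
import Relation.Binary.Reasoning.Setoid
open import Relation.Binary.PropositionalEquality
open import Relation.Nullary using (¬_; Dec; yes; no; contradiction)
open import Relation.Nullary.Decidable using (map′)

open import Algebra.Properties.Semiring.Sum +-*-semiring
  using (sum; sum-syntax; sum⁺-syntax; sum-cong-≗; sum-init-last; ∑-comm; *-distribˡ-sum)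
import Algebra.Properties.CommutativeSemiring.Binomial +-*-commutativeSemiring as Binomial
import Algebra.Properties.CommutativeSemiring.Exp +-*-commutativeSemiring as Exp
import Algebra.Properties.Monoid.Mult +-0-monoid as Mult

module Congruence (p : ℕ) .{{_ : NonZero p}} where

  infix 4 _≈_ _≈?_

  -- a ≈ b : a and b have the same remainder modulo p.  (A record, so
  -- that a and b can be inferred from a proof.)
  record _≈_ (a b : ℕ) : Set where
    constructor mod≡
    field same-remainder : a % p ≡ b % p
  open _≈_ public

  ≈-isEquivalence : IsEquivalence _≈_
  ≈-isEquivalence = record
    { refl  = mod≡ refl
    ; sym   = λ (mod≡ e) → mod≡ (sym e)
    ; trans = λ (mod≡ e) (mod≡ f) → mod≡ (trans e f)
    }

  ≈-setoid : Setoid 0ℓ 0ℓ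
  ≈-setoid = record { isEquivalence = ≈-isEquivalence }

  open IsEquivalence ≈-isEquivalence public
    using () renaming (refl to ≈-refl; sym to ≈-sym; trans to ≈-trans; reflexive to ≈-reflexive)

  +-≈ : ∀ {a b c d} → a ≈ b → c ≈ d → a + c ≈ b + d
  +-≈ {a} {b} {c} {d} (mod≡ e₁) (mod≡ e₂) = mod≡ (begin
    (a + c) % p          ≡⟨ %-distribˡ-+ a c p ⟩
    (a % p + c % p) % p  ≡⟨ cong₂ (λ u v → (u + v) % p) e₁ e₂ ⟩
    (b % p + d % p) % p  ≡⟨ %-distribˡ-+ b d p ⟨
    (b + d) % p          ∎)
    where open ≡-Reasoning

  *-≈ : ∀ {a b c d} → a ≈ b → c ≈ d → a * c ≈ b * d
  *-≈ {a} {b} {c} {d} (mod≡ e₁) (mod≡ e₂) = mod≡ (begin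
    (a * c) % p              ≡⟨ %-distribˡ-* a c p ⟩
    (a % p * (c % p)) % p    ≡⟨ cong₂ (λ u v → (u * v) % p) e₁ e₂ ⟩
    (b % p * (d % p)) % p    ≡⟨ %-distribˡ-* b d p ⟨
    (b * d) % p              ∎)
    where open ≡-Reasoning

  ^-≈ : ∀ {a b} k → a ≈ b → a ^ k ≈ b ^ k
  ^-≈ zero    _ = ≈-refl
  ^-≈ (suc k) e = *-≈ e (^-≈ k e)

  %-≈ : ∀ a → a % p ≈ a
  %-≈ a = mod≡ (m%n%n≡m%n a p)

  0%p≡0 : 0 % p ≡ 0
  0%p≡0 = m<n⇒m%n≡m (>-nonZero⁻¹ p)

  ∣⇒≈0 : ∀ {a} → p ∣ a → a ≈ 0
  ∣⇒≈0 {a} p∣a = mod≡ (trans (n∣m⇒m%n≡0 a p p∣a) (sym 0%p≡0))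

  ≈0⇒∣ : ∀ {a} → a ≈ 0 → p ∣ a
  ≈0⇒∣ {a} (mod≡ e) = m%n≡0⇒n∣m a p (trans e 0%p≡0)

  ≈⇒∣∸ : ∀ {a b} → a ≈ b → p ∣ a ∸ b
  ≈⇒∣∸ {a} {b} (mod≡ e) = divides (a / p ∸ b / p) (begin
    a ∸ b                                       ≡⟨ cong₂ _∸_ (m≡m%n+[m/n]*n a p) (m≡m%n+[m/n]*n b p) ⟩
    (a % p + a / p * p) ∸ (b % p + b / p * p)   ≡⟨ cong (λ r → (r + a / p * p) ∸ (b % p + b / p * p)) e ⟩
    (b % p + a / p * p) ∸ (b % p + b / p * p)   ≡⟨ [m+n]∸[m+o]≡n∸o (b % p) _ _ ⟩
    a / p * p ∸ b / p * p                       ≡⟨ *-distribʳ-∸ p (a / p) (b / p) ⟨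
    (a / p ∸ b / p) * p                         ∎)
    where open ≡-Reasoning

  ≤∧∣∸⇒≈ : ∀ {a b} → b ≤ a → p ∣ a ∸ b → a ≈ b
  ≤∧∣∸⇒≈ {a} {b} b≤a (divides q a∸b≡q*p) = mod≡ (begin
    a % p               ≡⟨ cong (_% p) (m+[n∸m]≡n b≤a) ⟨
    (b + (a ∸ b)) % p   ≡⟨ cong (λ c → (b + c) % p) a∸b≡q*p ⟩
    (b + q * p) % p     ≡⟨ [m+kn]%n≡m%n b q p ⟩
    b % p               ∎)
    where open ≡-Reasoning

  ∣∸⇒≈ : ∀ {a b} → p ∣ a ∸ b → p ∣ b ∸ a → a ≈ b
  ∣∸⇒≈ {a} {b} p∣a∸b p∣b∸a with ≤-total b a
  ... | inj₁ b≤a = ≤∧∣∸⇒≈ b≤a p∣a∸b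
  ... | inj₂ a≤b = ≈-sym (≤∧∣∸⇒≈ a≤b p∣b∸a)

  module ≈-Reasoning = Relation.Binary.Reasoning.Setoid ≈-setoid

  +-cancelʳ-≈ : ∀ {a b c} → a + c ≈ b + c → a ≈ b
  +-cancelʳ-≈ {a} {b} {c} e = ∣∸⇒≈ (subst (p ∣_) (drop-c a b) (≈⇒∣∸ e)) (subst (p ∣_) (drop-c b a) (≈⇒∣∸ (≈-sym e)))
    where
    drop-c : ∀ a b → a + c ∸ (b + c) ≡ a ∸ b
    drop-c a b = trans (cong₂ _∸_ (+-comm a c) (+-comm b c)) ([m+n]∸[m+o]≡n∸o c a b)

  -- If b ≡ -a then b² ≡ a²: both a² + ab and b² + ab are multiples of a + b.
  neg-square : ∀ {a b} → a + b ≈ 0 → a * a ≈ b * b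
  neg-square {a} {b} a+b≈0 = +-cancelʳ-≈ {c = a * b} (begin
    a * a + a * b   ≡⟨ *-distribˡ-+ a a b ⟨
    a * (a + b)     ≈⟨ *-≈ (≈-refl {a}) a+b≈0 ⟩
    a * 0           ≡⟨ *-zeroʳ a ⟩
    0               ≡⟨ *-zeroʳ b ⟨
    b * 0           ≈⟨ *-≈ (≈-refl {b}) a+b≈0 ⟨
    b * (a + b)     ≡⟨ cong (b *_) (+-comm a b) ⟩
    b * (b + a)     ≡⟨ *-distribˡ-+ b b a ⟩
    b * b + b * a   ≡⟨ cong (b * b +_) (*-comm b a) ⟩
    b * b + a * b   ∎)
    where open ≈-Reasoning

  _≈?_ : ∀ a b → Dec (a ≈ b)
  a ≈? b = map′ mod≡ same-remainder (a % p ≟ b % p)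

  ∑-≈ : ∀ {N} {f g : Fin N → ℕ} → (∀ i → f i ≈ g i) → sum f ≈ sum g
  ∑-≈ {zero}  f≈g = ≈-refl
  ∑-≈ {suc N} f≈g = +-≈ (f≈g Fin.zero) (∑-≈ (f≈g ∘ Fin.suc))

^-agrees : ∀ x k → x Exp.^ k ≡ x ^ k
^-agrees x zero    = refl
^-agrees x (suc k) = cong (x *_) (^-agrees x k)

×-agrees : ∀ c y → c Mult.× y ≡ c * y
×-agrees zero    y = refl
×-agrees (suc c) y = cong (y +_) (×-agrees c y)

*-^-distrib : ∀ a b k → (a * b) ^ k ≡ a ^ k * b ^ k
*-^-distrib a b k = begin
  (a * b) ^ k                ≡⟨ ^-agrees (a * b) k ⟨
  (a * b) Exp.^ k            ≡⟨ Exp.^-distrib-* a b k ⟩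
  a Exp.^ k * b Exp.^ k      ≡⟨ cong₂ _*_ (^-agrees a k) (^-agrees b k) ⟩
  a ^ k * b ^ k              ∎
  where open ≡-Reasoning

binomial : ∀ k x → (x + 1) ^ k ≡ ∑[ j ≤ k ] ((k C toℕ j) * x ^ toℕ j)
binomial k x = begin
  (x + 1) ^ k                        ≡⟨ ^-agrees (x + 1) k ⟨
  (x + 1) Exp.^ k                    ≡⟨ Binomial.theorem k x 1 ⟩
  Binomial.binomialExpansion x 1 k   ≡⟨ sum-cong-≗ term ⟩
  ∑[ j ≤ k ] ((k C toℕ j) * x ^ toℕ j) ∎
  where
  open ≡-Reasoning
  term : ∀ j → Binomial.binomialTerm x 1 k j ≡ (k C toℕ j) * x ^ toℕ j
  term j = begin
    (k C toℕ j) Mult.× (x Exp.^ toℕ j * 1 Exp.^ (k ∸ toℕ j))  ≡⟨ ×-agrees (k C toℕ j) _ ⟩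
    (k C toℕ j) * (x Exp.^ toℕ j * 1 Exp.^ (k ∸ toℕ j))       ≡⟨ cong₂ (λ a b → (k C toℕ j) * (a * b))
                                                                   (^-agrees x (toℕ j))
                                                                   (trans (^-agrees 1 (k ∸ toℕ j)) (^-zeroˡ (k ∸ toℕ j))) ⟩
    (k C toℕ j) * (x ^ toℕ j * 1)                             ≡⟨ cong ((k C toℕ j) *_) (*-identityʳ _) ⟩
    (k C toℕ j) * x ^ toℕ j                                   ∎

∑-last : ∀ N (f : ℕ → ℕ) → ∑[ j < suc N ] f (toℕ j) ≡ ∑[ j < N ] f (toℕ j) + f N
∑-last N f = begin
  ∑[ j < suc N ] f (toℕ j)                      ≡⟨ sum-init-last (f ∘ toℕ) ⟩
  ∑[ j < N ] f (toℕ (inject₁ j)) + f (toℕ (fromℕ N))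
                                                ≡⟨ cong₂ _+_ (sum-cong-≗ {N} (cong f ∘ toℕ-inject₁)) (cong f (toℕ-fromℕ N)) ⟩
  ∑[ j < N ] f (toℕ j) + f N                    ∎
  where open ≡-Reasoning

∑-∣ : ∀ {d N} (f : Fin N → ℕ) → (∀ i → d ∣ f i) → d ∣ sum f
∑-∣ {N = zero}  f d∣f = divides 0 refl
∑-∣ {N = suc N} f d∣f = ∣m∣n⇒∣m+n (d∣f Fin.zero) (∑-∣ (f ∘ Fin.suc) (d∣f ∘ Fin.suc))

∑-ones : ∀ N → ∑[ i < N ] 1 ≡ N
∑-ones zero    = refl
∑-ones (suc N) = cong suc (∑-ones N)

-- Arithmetic modulo a prime.  The prime is written suc m, so that sums
-- over Fin p unfold by computation.
module PrimeModulus (m : ℕ) (prime : Prime (suc m)) where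

  p : ℕ
  p = suc m

  open Congruence p public

  1<p : 1 < p
  1<p = nonTrivial⇒n>1 p {{prime⇒nonTrivial prime}}

  0<m : 0 < m
  0<m = s≤s⁻¹ 1<p

  ∤-between : ∀ {a} → 0 < a → a < p → ¬ p ∣ a
  ∤-between {suc a} _ a<p p∣a = <⇒≱ a<p (∣⇒≤ p∣a)

  ∤-* : ∀ {a b} → ¬ p ∣ a → ¬ p ∣ b → ¬ p ∣ a * b
  ∤-* {a} {b} p∤a p∤b p∣ab with euclidsLemma a b prime p∣ab
  ... | inj₁ p∣a = p∤a p∣a
  ... | inj₂ p∣b = p∤b p∣b

  ∤-^ : ∀ {a} k → ¬ p ∣ a → ¬ p ∣ a ^ k
  ∤-^ zero    p∤a = ∤-between z<s 1<p
  ∤-^ (suc k) p∤a = ∤-* p∤a (∤-^ k p∤a)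

  ∤-! : ∀ a → a < p → ¬ p ∣ a !
  ∤-! zero    _   = ∤-between z<s 1<p
  ∤-! (suc a) a<p = ∤-* (∤-between z<s a<p) (∤-! a (<-trans (n<1+n a) a<p))

  *-cancelˡ-≈ : ∀ {c a b} → ¬ p ∣ c → c * a ≈ c * b → a ≈ b
  *-cancelˡ-≈ {c} p∤c ca≈cb = ∣∸⇒≈ (∣difference ca≈cb) (∣difference (≈-sym ca≈cb))
    where
    ∣difference : ∀ {a b} → c * a ≈ c * b → p ∣ a ∸ b
    ∣difference {a} {b} e with euclidsLemma c (a ∸ b) prime (subst (p ∣_) (sym (*-distribˡ-∸ c a b)) (≈⇒∣∸ e))
    ... | inj₁ p∣c   = contradiction p∣c p∤c
    ... | inj₂ p∣a∸b = p∣a∸b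

  -- p divides the inner binomial coefficients C(p, k), 0 < k < p:
  -- C(p, k) · k! · (p - k)! = p!, while p divides neither k! nor (p - k)!.
  ∣-binomial : ∀ k → 0 < k → k < p → p ∣ p C k
  ∣-binomial k 0<k k<p with euclidsLemma (p C k) (k ! * (p ∸ k) !) prime p∣product
    where
    instance _ = k !* (p ∸ k) !≢0
    p∣product : p ∣ (p C k) * (k ! * (p ∸ k) !)
    p∣product = subst (p ∣_) (sym (begin
      (p C k) * (k ! * (p ∸ k) !)                ≡⟨ cong (_* (k ! * (p ∸ k) !)) (nCk≡n!/k![n-k]! (<⇒≤ k<p)) ⟩
      p ! / (k ! * (p ∸ k) !) * (k ! * (p ∸ k) !) ≡⟨ m/n*n≡m (k![n∸k]!∣n! (<⇒≤ k<p)) ⟩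
      p !                                        ∎)) (m∣m*n (m !))
      where open ≡-Reasoning
  ... | inj₁ p∣pCk = p∣pCk
  ... | inj₂ p∣k![p-k]! =
    contradiction p∣k![p-k]! (∤-* (∤-! k k<p) (∤-! (p ∸ k) (∸-monoʳ-< 0<k (<⇒≤ k<p))))

  -- (x + 1)ᵖ ≡ xᵖ + 1: all inner terms of the binomial expansion vanish.
  frobenius : ∀ x → (x + 1) ^ p ≈ x ^ p + 1
  frobenius x = begin
    (x + 1) ^ p                                  ≡⟨ binomial p x ⟩
    1 + ∑[ j < p ] inner (toℕ j)                 ≡⟨ cong (1 +_) (∑-last m inner) ⟩
    1 + (∑[ j < m ] inner (toℕ j) + inner m)     ≈⟨ +-≈ (≈-refl {1}) (+-≈ (∣⇒≈0 inner-sum) ≈-refl) ⟩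
    1 + (0 + (p C p) * x ^ p)                    ≡⟨ cong (λ c → 1 + c * x ^ p) (nCn≡1 p) ⟩
    1 + (1 * x ^ p)                              ≡⟨ +-comm 1 (1 * x ^ p) ⟩
    1 * x ^ p + 1                                ≡⟨ cong (_+ 1) (*-identityˡ (x ^ p)) ⟩
    x ^ p + 1                                    ∎
    where
    open ≈-Reasoning
    inner : ℕ → ℕ
    inner j = (p C suc j) * x ^ suc j
    inner-sum : p ∣ ∑[ j < m ] inner (toℕ j)
    inner-sum = ∑-∣ (inner ∘ toℕ) (λ j → ∣m⇒∣m*n (x ^ suc (toℕ j))
                  (∣-binomial (suc (toℕ j)) z<s (s≤s (toℕ<n j))))

  fermat : ∀ x → x ^ p ≈ x
  fermat zero    = ≈-refl
  fermat (suc x) = begin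
    suc x ^ p      ≡⟨ cong (_^ p) (+-comm 1 x) ⟩
    (x + 1) ^ p    ≈⟨ frobenius x ⟩
    x ^ p + 1      ≈⟨ +-≈ (fermat x) ≈-refl ⟩
    x + 1          ≡⟨ +-comm x 1 ⟩
    suc x          ∎
    where open ≈-Reasoning

  fermat-unit : ∀ {x} → ¬ p ∣ x → x ^ m ≈ 1
  fermat-unit {x} p∤x = *-cancelˡ-≈ p∤x (≈-trans (fermat x) (≈-reflexive (sym (*-identityʳ x))))

  S : ℕ → ℕ
  S k = ∑[ x < p ] (toℕ x ^ k)

  -- Summing the binomial expansion of (x + 1)ᵏ⁺¹ over 0 ≤ x < p
  -- telescopes:  Σ_{j ≤ k} C(k + 1, j) Sⱼ = pᵏ⁺¹.
  power-sum-identity : ∀ k → ∑[ j < suc k ] ((suc k C toℕ j) * S (toℕ j)) ≡ p ^ suc k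
  power-sum-identity k = +-cancelʳ-≡ (S K) _ _ (begin
    ∑[ j < K ] T (toℕ j) + S K                   ≡⟨ cong (∑[ j < K ] T (toℕ j) +_) (sym top-term) ⟩
    ∑[ j < K ] T (toℕ j) + T K                   ≡⟨ ∑-last K T ⟨
    ∑[ j ≤ K ] T (toℕ j)                         ≡⟨ sum-cong-≗ {suc K} (λ j → *-distribˡ-sum {p} (K C toℕ j) (λ x → toℕ x ^ toℕ j)) ⟩
    ∑[ j ≤ K ] ∑[ x < p ] ((K C toℕ j) * toℕ x ^ toℕ j)
                                                 ≡⟨ ∑-comm {p} {suc K} (λ x j → (K C toℕ j) * toℕ x ^ toℕ j) ⟨
    ∑[ x < p ] ∑[ j ≤ K ] ((K C toℕ j) * toℕ x ^ toℕ j)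
                                                 ≡⟨ sum-cong-≗ {p} (λ x → binomial K (toℕ x)) ⟨
    ∑[ x < p ] ((toℕ x + 1) ^ K)                 ≡⟨ sum-cong-≗ {p} (λ x → cong (_^ K) (+-comm (toℕ x) 1)) ⟩
    ∑[ x < p ] (suc (toℕ x) ^ K)                 ≡⟨ +-identityʳ _ ⟨
    ∑[ x < p ] (suc (toℕ x) ^ K) + 0 ^ K          ≡⟨ +-comm _ (0 ^ K) ⟩
    ∑[ x < suc p ] (toℕ x ^ K)                   ≡⟨ ∑-last p (_^ K) ⟩
    S K + p ^ K                                  ≡⟨ +-comm (S K) _ ⟩
    p ^ K + S K                                  ∎)
    where
    open ≡-Reasoning
    K = suc k
    T : ℕ → ℕ
    T j = (K C j) * S j
    top-term : T K ≡ S K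
    top-term = trans (cong (_* S K) (nCn≡1 K)) (*-identityˡ (S K))

  -- Hence p ∣ Sₖ for k < p - 1, by strong induction on k: in the
  -- identity for k, all terms but C(k + 1, k) Sₖ = (k + 1) Sₖ are
  -- known to be multiples of p, and k + 1 is a unit.
  power-sum-vanishes : ∀ k → suc k < p → p ∣ S k
  power-sum-vanishes = <-rec (λ k → suc k < p → p ∣ S k) step
    where
    step : ∀ k → (∀ {j} → j < k → suc j < p → p ∣ S j) → suc k < p → p ∣ S k
    step k ih k+1<p with euclidsLemma (suc k) (S k) prime p∣[k+1]Sₖ
      where
      lower : p ∣ ∑[ j < k ] ((suc k C toℕ j) * S (toℕ j))
      lower = ∑-∣ _ (λ j → ∣n⇒∣m*n (suc k C toℕ j)
                (ih (toℕ<n j) (<-trans (s≤s (toℕ<n j)) k+1<p)))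
      [k+1]Ck≡k+1 : suc k C k ≡ suc k
      [k+1]Ck≡k+1 = trans (nCk≡nC[n∸k] (n≤1+n k)) (trans (cong (suc k C_) (m+n∸n≡m 1 k)) (nC1≡n (suc k)))
      split : p ^ suc k ≡ ∑[ j < k ] ((suc k C toℕ j) * S (toℕ j)) + suc k * S k
      split = begin
        p ^ suc k                                                 ≡⟨ power-sum-identity k ⟨
        ∑[ j < suc k ] ((suc k C toℕ j) * S (toℕ j))              ≡⟨ ∑-last k (λ j → (suc k C j) * S j) ⟩
        ∑[ j < k ] ((suc k C toℕ j) * S (toℕ j)) + (suc k C k) * S k
                                                                  ≡⟨ cong (λ c → ∑[ j < k ] ((suc k C toℕ j) * S (toℕ j)) + c * S k) [k+1]Ck≡k+1 ⟩
        ∑[ j < k ] ((suc k C toℕ j) * S (toℕ j)) + suc k * S k    ∎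
        where open ≡-Reasoning
      p∣[k+1]Sₖ : p ∣ suc k * S k
      p∣[k+1]Sₖ = ∣m+n∣m⇒∣n (subst (p ∣_) split (m∣m*n (p ^ k))) lower
    ... | inj₁ p∣k+1 = contradiction p∣k+1 (∤-between z<s k+1<p)
    ... | inj₂ p∣Sₖ  = p∣Sₖ

  -- If all units x = 1, …, p - 1 satisfied xᵏ ≡ 1 (0 < k < p - 1), then
  -- Sₖ ≡ (p - 1)·1 = m; but p ∣ Sₖ and 0 < m < p.
  not-all-units-roots : ∀ k → suc (suc k) < p → ¬ (∀ (i : Fin m) → suc (toℕ i) ^ suc k ≈ 1)
  not-all-units-roots k k+2<p all-roots = ∤-between 0<m (n<1+n m) (≈0⇒∣ (begin
    m                                    ≡⟨ ∑-ones m ⟨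
    ∑[ i < m ] 1                         ≈⟨ ∑-≈ all-roots ⟨
    ∑[ i < m ] (suc (toℕ i) ^ suc k)     ≡⟨⟩
    S (suc k)                            ≈⟨ ∣⇒≈0 (power-sum-vanishes (suc k) k+2<p) ⟩
    0                                    ∎))
    where open ≈-Reasoning

  nonresidue : ∀ k → 0 < k → suc k < p → ∃ λ x → ¬ p ∣ x × ¬ x ^ k ≈ 1
  nonresidue (suc k) _ k+2<p =
    unit-witness (¬∀⟶∃¬ m (λ i → suc (toℕ i) ^ suc k ≈ 1) (λ i → suc (toℕ i) ^ suc k ≈? 1)
                         (not-all-units-roots k k+2<p))
    where
    unit-witness : (∃ λ (i : Fin m) → ¬ suc (toℕ i) ^ suc k ≈ 1) → ∃ λ x → ¬ p ∣ x × ¬ x ^ suc k ≈ 1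
    unit-witness (i , non-root) = suc (toℕ i) , ∤-between z<s (s≤s (toℕ<n i)) , non-root

  root-of-unity : ∀ q r s → 0 < r → 1 < s → m ≡ q * (r * s) →
                  ∃ λ ζ → ¬ p ∣ ζ × ζ ^ (r * s) ≈ 1 × ¬ ζ ^ r ≈ 1
  root-of-unity zero r s _ _ m≡0 = contradiction (subst (0 <_) m≡0 0<m) λ ()
  root-of-unity q@(suc _) r s 0<r 1<s m≡qrs = power-of-nonresidue (nonresidue (q * r) 0<qr qr+1<p)
    where
    instance _ = >-nonZero 0<r
    0<qr : 0 < q * r
    0<qr = >-nonZero⁻¹ (q * r) {{m*n≢0 q r}}
    qr+1<p : suc (q * r) < p
    qr+1<p = s≤s (begin-strict
      q * r         <⟨ *-monoʳ-< q (m<m*n r s 1<s) ⟩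
      q * (r * s)   ≡⟨ m≡qrs ⟨
      m             ∎)
      where open ≤-Reasoning
    power-of-nonresidue : (∃ λ x → ¬ p ∣ x × ¬ x ^ (q * r) ≈ 1) →
                          ∃ λ ζ → ¬ p ∣ ζ × ζ ^ (r * s) ≈ 1 × ¬ ζ ^ r ≈ 1
    power-of-nonresidue (x , p∤x , xᑫʳ≉1) = x ^ q , ∤-^ q p∤x , ζʳˢ≈1 , ζʳ≉1
      where
      ζʳˢ≈1 : (x ^ q) ^ (r * s) ≈ 1
      ζʳˢ≈1 = ≈-trans (≈-reflexive (trans (^-*-assoc x q (r * s)) (cong (x ^_) (sym m≡qrs)))) (fermat-unit p∤x)
      ζʳ≉1 : ¬ (x ^ q) ^ r ≈ 1
      ζʳ≉1 = xᑫʳ≉1 ∘ ≈-trans (≈-reflexive (sym (^-*-assoc x q r)))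

-- The i-th odd number 2i + 1; the numbers 2k - 1 (1 ≤ k ≤ n) of the
-- theorem are odd 0, …, odd (n - 1).
odd : ℕ → ℕ
odd i = suc (2 * i)

odd-index : ∀ i → 2 * suc i ∸ 1 ≡ odd i
odd-index i = cong (_∸ 1) (*-suc 2 i)

even-or-odd : ∀ r → ∃ λ t → r ≡ 2 * t ⊎ r ≡ odd t
even-or-odd zero = 0 , inj₁ refl
even-or-odd (suc r) with even-or-odd r
... | t , inj₁ r≡2t  = t , inj₂ (cong suc r≡2t)
... | t , inj₂ r≡odd = suc t , inj₁ (trans (cong suc r≡odd) (sym (*-suc 2 t)))

odd∸even : ∀ {h t} → t ≤ h → odd h ∸ 2 * t ≡ odd (h ∸ t)
odd∸even {h} {t} t≤h = begin
  suc (2 * h) ∸ 2 * t     ≡⟨ +-∸-assoc 1 (*-monoʳ-≤ 2 t≤h) ⟩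
  suc (2 * h ∸ 2 * t)     ≡⟨ cong suc (*-distribˡ-∸ 2 h t) ⟨
  suc (2 * (h ∸ t))       ∎
  where open ≡-Reasoning

odd+odd : ∀ i j → suc (2 * i) + suc (2 * j) ≡ 2 * suc (i + j)
odd+odd = solve-∀

difference-of-squares : ∀ x y → x * x ∸ y * y ≡ (x + y) * (x ∸ y)
difference-of-squares x y = begin
  x * x ∸ y * y                     ≡⟨ [m+n]∸[m+o]≡n∸o (y * x) (x * x) (y * y) ⟨
  (y * x + x * x) ∸ (y * x + y * y) ≡⟨ cong₂ _∸_ (+-comm (y * x) (x * x)) (cong (_+ y * y) (*-comm y x)) ⟩
  (x * x + y * x) ∸ (x * y + y * y) ≡⟨ cong₂ _∸_ (*-distribʳ-+ x x y) (*-distribʳ-+ y x y) ⟨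
  (x + y) * x ∸ (x + y) * y         ≡⟨ *-distribˡ-∸ (x + y) x y ⟨
  (x + y) * (x ∸ y)                 ∎
  where open ≡-Reasoning

square-* : ∀ a b → (a * b) * (a * b) ≡ (a * a) * (b * b)
square-* = solve-∀

^-even : ∀ x e → x ^ (e * 2) ≡ (x * x) ^ e
^-even x e = begin
  x ^ (e * 2)   ≡⟨ cong (x ^_) (*-comm e 2) ⟩
  x ^ (2 * e)   ≡⟨ ^-*-assoc x 2 e ⟨
  (x ^ 2) ^ e   ≡⟨ cong (λ y → (x * y) ^ e) (*-identityʳ x) ⟩
  (x * x) ^ e   ∎
  where open ≡-Reasoning

module OddPrime (m : ℕ) (prime : Prime (suc m)) (2<p : 2 < suc m) where

  open PrimeModulus m prime public

  p-odd : ∃ λ h → p ≡ odd h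
  p-odd with even-or-odd p
  ... | h , inj₂ p≡odd = h , p≡odd
  ... | h , inj₁ p≡2h  = contradiction (composite 2<p (divides h (trans p≡2h (*-comm 2 h))))
                                       (Prime.notComposite prime)

  square-roots : ∀ x y → x * x ≈ y * y → p ∣ x + y ⊎ p ∣ x ∸ y
  square-roots x y x²≈y² =
    euclidsLemma (x + y) (x ∸ y) prime (subst (p ∣_) (difference-of-squares x y) (≈⇒∣∸ x²≈y²))

  -- Distinct odd numbers in [1, p] have distinct squares modulo p: their
  -- difference lies strictly between 0 and p, and their sum is twice a
  -- number strictly between 0 and p.
  odd-squares-distinct-< : ∀ {i j} → j < i → odd i ≤ p → ¬ odd i * odd i ≈ odd j * odd j
  odd-squares-distinct-< {i} {j} j<i i≤p e with square-roots (odd i) (odd j) e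
  ... | inj₂ p∣difference =
    ∤-between (m<n⇒0<n∸m odd-j<odd-i) (<-≤-trans (∸-monoʳ-< z<s (<⇒≤ odd-j<odd-i)) i≤p) p∣difference
    where odd-j<odd-i = s≤s (*-monoʳ-< 2 j<i)
  ... | inj₁ p∣sum with euclidsLemma 2 (suc (i + j)) prime (subst (p ∣_) (odd+odd i j) p∣sum)
  ...   | inj₁ p∣2     = ∤-between z<s 2<p p∣2
  ...   | inj₂ p∣i+j+1 = ∤-between z<s i+j+1<p p∣i+j+1
    where
    i+j+1<p : suc (i + j) < p
    i+j+1<p = *-cancelˡ-< 2 _ _ (begin-strict
      2 * suc (i + j)  ≡⟨ odd+odd i j ⟨
      odd i + odd j    <⟨ +-mono-≤-< i≤p (<-≤-trans (s≤s (*-monoʳ-< 2 j<i)) i≤p) ⟩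
      p + p            ≡⟨ cong (p +_) (+-identityʳ p) ⟨
      2 * p            ∎)
      where open ≤-Reasoning

  odd-squares-distinct : ∀ {i j} → i ≢ j → odd i ≤ p → odd j ≤ p → ¬ odd i * odd i ≈ odd j * odd j
  odd-squares-distinct {i} {j} i≢j i≤p j≤p e with <-cmp i j
  ... | tri< i<j _ _ = odd-squares-distinct-< i<j j≤p (≈-sym e)
  ... | tri≈ _ i≡j _ = i≢j i≡j
  ... | tri> _ _ j<i = odd-squares-distinct-< j<i i≤p e

  -- Every unit z is congruent to ± an odd number below p: reduce z
  -- modulo p to r; if r is even, p - r is odd, and (p - r)² ≡ r².
  odd-representative : ∀ z → ¬ p ∣ z → ∃ λ t → odd t < p × odd t * odd t ≈ z * z
  odd-representative z p∤z with even-or-odd (z % p) | m%n<n z p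
  ... | t , inj₂ r≡odd | r<p = t , subst (_< p) r≡odd r<p , subst (λ r → r * r ≈ z * z) r≡odd (*-≈ (%-≈ z) (%-≈ z))
  ... | zero , inj₁ r≡0 | _  = contradiction (m%n≡0⇒n∣m z p r≡0) p∤z
  ... | t@(suc _) , inj₁ r≡2t | r<p with p-odd
  ...   | h , p≡odd-h = h ∸ t , odd-below-p , square-congruent
    where
    r = z % p
    p∸r≡odd : p ∸ r ≡ odd (h ∸ t)
    p∸r≡odd = trans (cong₂ _∸_ p≡odd-h r≡2t)
                    (odd∸even {h} {t} (*-cancelˡ-≤ 2 (s≤s⁻¹ (subst₂ _<_ r≡2t p≡odd-h r<p))))
    odd-below-p : odd (h ∸ t) < p
    odd-below-p = subst (_< p) p∸r≡odd (∸-monoʳ-< (subst (0 <_) (sym r≡2t) z<s) (<⇒≤ r<p))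
    square-congruent : odd (h ∸ t) * odd (h ∸ t) ≈ z * z
    square-congruent = subst (λ u → u * u ≈ z * z) p∸r≡odd (begin
      (p ∸ r) * (p ∸ r)  ≈⟨ neg-square {p ∸ r} {r} (≈-trans (≈-reflexive (m∸n+n≡m (<⇒≤ r<p))) (∣⇒≈0 ∣-refl)) ⟩
      r * r              ≈⟨ *-≈ (%-≈ z) (%-≈ z) ⟩
      z * z              ∎)
      where open ≈-Reasoning

  -- For the direction (⇐): if d ∣ p + 1, then xᵈ ≡ yᵈ implies x² ≡ y²,
  -- because x² ≡ x·xᵖ = xᵖ⁺¹ is a power of xᵈ.
  squares-from-powers : ∀ {d x y} → d ∣ p + 1 → x ^ d ≈ y ^ d → x * x ≈ y * y
  squares-from-powers {d} {x} {y} (divides q p+1≡qd) xᵈ≈yᵈ = begin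
    x * x          ≈⟨ *-≈ (≈-refl {x}) (fermat x) ⟨
    x * x ^ p      ≡⟨ power-of-power x ⟩
    (x ^ d) ^ q    ≈⟨ ^-≈ q xᵈ≈yᵈ ⟩
    (y ^ d) ^ q    ≡⟨ power-of-power y ⟨
    y * y ^ p      ≈⟨ *-≈ (≈-refl {y}) (fermat y) ⟩
    y * y          ∎
    where
    open ≈-Reasoning
    power-of-power : ∀ x → x * x ^ p ≡ (x ^ d) ^ q
    power-of-power x = trans (cong (x ^_) (trans (+-comm 1 p) (trans p+1≡qd (*-comm q d)))) (sym (^-*-assoc x d q))

  distinct-if-divides : ∀ n d → 2 * n ∸ 1 ≤ p → d ∣ p + 1 → PairwiseDistinctMod n d p
  distinct-if-divides n d 2n-1≤p d∣p+1 (suc i) (suc j) _ i<n _ j<n i+1≢j+1 e =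
    odd-squares-distinct (i+1≢j+1 ∘ cong suc) (odd≤p i<n) (odd≤p j<n)
      (squares-from-powers d∣p+1 (mod≡ (subst₂ (λ a b → a ^ d % p ≡ b ^ d % p) (odd-index i) (odd-index j) e)))
    where
    odd≤p : ∀ {i} → suc i ≤ n → odd i ≤ p
    odd≤p {i} i<n = subst (_≤ p) (odd-index i) (≤-trans (∸-monoˡ-≤ 1 (*-monoʳ-≤ 2 i<n)) 2n-1≤p)

  powers-from-squares : ∀ {d x y} → 2 ∣ d → x * x ≈ y * y → x ^ d ≈ y ^ d
  powers-from-squares {d} {x} {y} (divides e d≡e*2) x²≈y² = begin
    x ^ d        ≡⟨ as-power-of-square x ⟩
    (x * x) ^ e  ≈⟨ ^-≈ e x²≈y² ⟩
    (y * y) ^ e  ≡⟨ as-power-of-square y ⟨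
    y ^ d        ∎
    where
    open ≈-Reasoning
    as-power-of-square : ∀ x → x ^ d ≡ (x * x) ^ e
    as-power-of-square x = trans (cong (x ^_) d≡e*2) (^-even x e)

  distinct-odd-powers : ∀ {n d i j} → PairwiseDistinctMod n d p → i < n → j < n → i ≢ j →
                        ¬ odd i ^ d ≈ odd j ^ d
  distinct-odd-powers {d = d} {i} {j} distinct i<n j<n i≢j (mod≡ e) =
    distinct (suc i) (suc j) (s≤s z≤n) i<n (s≤s z≤n) j<n (i≢j ∘ suc-injective)
      (subst₂ (λ a b → a ^ d % p ≡ b ^ d % p) (sym (odd-index i)) (sym (odd-index j)) e)

  -- With n = k + 1 and p < 3n, the offsets odd t - odd n of the odd numbers
  -- odd t in [odd n, p) range over fewer than k values.
  few-slots : ∀ k → p < 3 * suc k → p ∸ odd (suc k) < k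
  few-slots zero      p<3   = contradiction p<3 (≤⇒≯ 2<p)
  few-slots k@(suc _) p<3n  = m<n+o⇒m∸n<o p (odd (suc k)) (subst (p <_) (3n≡ k) p<3n)
    where
    3n≡ : ∀ k → 3 * suc k ≡ suc (2 * suc k) + k
    3n≡ = solve-∀

  module Collision {d ζ} (2∣d : 2 ∣ d) (p∤ζ : ¬ p ∣ ζ) (ζᵈ≈1 : ζ ^ d ≈ 1) (ζ²≉1 : ¬ ζ * ζ ≈ 1) where

    -- If the d-th powers of odd 0, …, odd (n - 1) are distinct modulo p,
    -- then for i < n the odd representative of ±ζ·(odd i) is odd t with t ≥ n:
    -- t = i would force ζ² ≡ 1, and any other t < n would give
    -- (odd t)ᵈ ≡ ζᵈ (odd i)ᵈ ≡ (odd i)ᵈ.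
    reflection : ∀ {n} → PairwiseDistinctMod n d p → ∀ i → i < n → odd i < p →
                 ∃ λ t → n ≤ t × odd t < p × odd t * odd t ≈ (ζ * odd i) * (ζ * odd i)
    reflection {n} distinct i i<n odd-i<p with odd-representative (ζ * odd i) (∤-* p∤ζ p∤odd-i)
      where p∤odd-i = ∤-between z<s odd-i<p
    ... | t , odd-t<p , t²≈ with t <? n
    ...   | no  t≮n = t , ≮⇒≥ t≮n , odd-t<p , t²≈
    ...   | yes t<n with t ≟ i
    ...     | yes refl = contradiction (≈-sym (*-cancelˡ-≈ (∤-* p∤odd-t p∤odd-t) (begin
                (odd t * odd t) * 1         ≡⟨ *-identityʳ _ ⟩
                odd t * odd t               ≈⟨ t²≈ ⟩
                (ζ * odd t) * (ζ * odd t)   ≡⟨ square-* ζ (odd t) ⟩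
                (ζ * ζ) * (odd t * odd t)   ≡⟨ *-comm (ζ * ζ) _ ⟩
                (odd t * odd t) * (ζ * ζ)   ∎))) ζ²≉1
      where
      open ≈-Reasoning
      p∤odd-t = ∤-between z<s odd-t<p
    ...     | no  t≢i = ⊥-elim (distinct-odd-powers {d = d} distinct t<n i<n t≢i (begin
                odd t ^ d                   ≈⟨ powers-from-squares 2∣d t²≈ ⟩
                (ζ * odd i) ^ d             ≡⟨ *-^-distrib ζ (odd i) d ⟩
                ζ ^ d * odd i ^ d           ≈⟨ *-≈ ζᵈ≈1 ≈-refl ⟩
                1 * odd i ^ d               ≡⟨ *-identityˡ _ ⟩
                odd i ^ d                   ∎))
      where open ≈-Reasoning

    -- If moreover 2n - 1 ≤ p < 3n, the n - 1 odd numbers odd i, i < n - 1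
    -- (all below p), are reflected into the fewer than n - 1 odd numbers in
    -- [2n + 1, p).  So two of them, i ≠ j, share their representative; then
    -- (ζ·odd i)² ≡ (ζ·odd j)², hence (odd i)² ≡ (odd j)²: impossible.
    no-distinct-powers : ∀ n → 2 * n ∸ 1 ≤ p → p < 3 * n → ¬ PairwiseDistinctMod n d p
    no-distinct-powers zero    _ () _
    no-distinct-powers (suc k) 2n-1≤p p<3n distinct = collide (pigeonhole (few-slots k p<3n) slot)
      where
      n = suc k
      odd<p : (i : Fin k) → odd (toℕ i) < p
      odd<p i = <-≤-trans (s≤s (*-monoʳ-< 2 (toℕ<n i))) (subst (_≤ p) (odd-index k) 2n-1≤p)
      image : (i : Fin k) → ∃ λ t → n ≤ t × odd t < p × odd t * odd t ≈ (ζ * odd (toℕ i)) * (ζ * odd (toℕ i))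
      image i = reflection distinct (toℕ i) (m<n⇒m<1+n (toℕ<n i)) (odd<p i)
      t : Fin k → ℕ
      t i = proj₁ (image i)
      slot-index : ∀ i → odd (t i) ∸ odd n < p ∸ odd n
      slot-index i with image i
      ... | _ , n≤t , odd-t<p , _ = ∸-monoˡ-< odd-t<p (s≤s (*-monoʳ-≤ 2 n≤t))
      slot : Fin k → Fin (p ∸ odd n)
      slot i = fromℕ< (slot-index i)
      ζ-square : ∀ i → odd (t i) * odd (t i) ≈ (ζ * ζ) * (odd (toℕ i) * odd (toℕ i))
      ζ-square i = ≈-trans (proj₂ (proj₂ (proj₂ (image i)))) (≈-reflexive (square-* ζ (odd (toℕ i))))
      collide : (∃₂ λ i j → i Fin.< j × slot i ≡ slot j) → ⊥
      collide (i , j , i<j , same-slot) =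
        odd-squares-distinct (<⇒≢ i<j) (<⇒≤ (odd<p i)) (<⇒≤ (odd<p j))
          (*-cancelˡ-≈ (∤-* p∤ζ p∤ζ) (≈-trans (≈-sym (ζ-square i)) (≈-trans (≈-reflexive (cong (λ u → u * u) same-t)) (ζ-square j))))
        where
        same-t : odd (t i) ≡ odd (t j)
        same-t = ∸-cancelʳ-≡ (s≤s (*-monoʳ-≤ 2 (proj₁ (proj₂ (image i))))) (s≤s (*-monoʳ-≤ 2 (proj₁ (proj₂ (image j)))))
                   (trans (sym (toℕ-fromℕ< (slot-index i))) (trans (cong toℕ same-slot) (toℕ-fromℕ< (slot-index j))))

module PrimeAbove3 (m : ℕ) (prime : Prime (suc m)) (3<p : 3 < suc m) where

  open OddPrime m prime (<-trans (n<1+n 2) 3<p) public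

  RootOfUnity : ℕ → Set
  RootOfUnity d = ∃ λ ζ → ¬ p ∣ ζ × ζ ^ d ≈ 1 × ¬ ζ * ζ ≈ 1

  root-multiple : ∀ {a} b → RootOfUnity a → RootOfUnity (a * b)
  root-multiple {a} b (ζ , p∤ζ , ζᵃ≈1 , ζ²≉1) = ζ , p∤ζ , ζᵃᵇ≈1 , ζ²≉1
    where
    ζᵃᵇ≈1 : ζ ^ (a * b) ≈ 1
    ζᵃᵇ≈1 = ≈-trans (≈-reflexive (sym (^-*-assoc ζ a b))) (≈-trans (^-≈ b ζᵃ≈1) (≈-reflexive (^-zeroˡ b)))

  fourth-root : 4 ∣ m → RootOfUnity 4
  fourth-root (divides q m≡4q) with root-of-unity q 2 2 z<s (n<1+n 1) m≡4q
  ... | ζ , p∤ζ , ζ⁴≈1 , ζ²≉1 = ζ , p∤ζ , ζ⁴≈1 , ζ²≉1 ∘ ≈-trans (≈-reflexive (cong (ζ *_) (*-identityʳ ζ)))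

  -- If 3 ∣ p - 1 there is a cube root of unity ζ ≢ 1; then also ζ² ≢ 1,
  -- as ζ² ≡ 1 would give ζ ≡ ζ³ ≡ 1.
  cube-root : 3 ∣ m → RootOfUnity 3
  cube-root (divides q m≡3q) with root-of-unity q 1 3 z<s (s≤s (s≤s z≤n)) m≡3q
  ... | ζ , p∤ζ , ζ³≈1 , ζ≉1 = ζ , p∤ζ , ζ³≈1 , ζ²≉1
    where
    ζ²≉1 : ¬ ζ * ζ ≈ 1
    ζ²≉1 ζ²≈1 = ζ≉1 (begin
      ζ * 1               ≈⟨ *-≈ (≈-refl {ζ}) ζ²≈1 ⟨
      ζ * (ζ * ζ)         ≡⟨ cong (λ x → ζ * (ζ * x)) (*-identityʳ ζ) ⟨
      ζ ^ 3               ≈⟨ ζ³≈1 ⟩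
      1                   ∎)
      where open ≈-Reasoning

  p±1-mod-4 : 4 ∣ p + 1 ⊎ 4 ∣ m
  p±1-mod-4 with p-odd
  ... | h , p≡odd-h with even-or-odd h
  ...   | u , inj₁ h≡2u   = inj₂ (divides u (trans (suc-injective (trans p≡odd-h (cong odd h≡2u))) (m≡ u)))
    where
    m≡ : ∀ u → 2 * (2 * u) ≡ u * 4
    m≡ = solve-∀
  ...   | u , inj₂ h≡odd-u = inj₁ (divides (suc u) (trans (cong (_+ 1) (trans p≡odd-h (cong odd h≡odd-u))) (p+1≡ u)))
    where
    p+1≡ : ∀ u → suc (2 * suc (2 * u)) + 1 ≡ suc u * 4
    p+1≡ = solve-∀

  p±1-mod-3 : 3 ∣ p + 1 ⊎ 3 ∣ m
  p±1-mod-3 with m % 3 | m%n<n m 3 | m≡m%n+[m/n]*n m 3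
  ... | 0 | _ | m≡3q   = inj₂ (divides (m / 3) m≡3q)
  ... | 1 | _ | m≡1+3q = inj₁ (divides (suc (m / 3)) (trans (cong (λ m → suc m + 1) m≡1+3q) (p+1≡ (m / 3))))
    where
    p+1≡ : ∀ q → suc (1 + q * 3) + 1 ≡ suc q * 3
    p+1≡ = solve-∀
  ... | 2 | _ | m≡2+3q = contradiction (composite 3<p (divides (suc (m / 3)) (cong suc m≡2+3q)))
                                       (Prime.notComposite prime)
  ... | suc (suc (suc _)) | s≤s (s≤s (s≤s ())) | _

  2∣p+1 : 2 ∣ p + 1
  2∣p+1 with p-odd
  ... | h , p≡odd-h = divides (suc h) (trans (cong (_+ 1) p≡odd-h) (p+1≡ h))
    where
    p+1≡ : ∀ h → suc (2 * h) + 1 ≡ suc h * 2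
    p+1≡ = solve-∀

  divides-or-root : ∀ {d} → d ≡ 4 ⊎ d ≡ 6 ⊎ d ≡ 12 → d ∣ p + 1 ⊎ RootOfUnity d
  divides-or-root (inj₁ refl) with p±1-mod-4
  ... | inj₁ 4∣p+1 = inj₁ 4∣p+1
  ... | inj₂ 4∣m   = inj₂ (fourth-root 4∣m)
  divides-or-root (inj₂ (inj₁ refl)) with p±1-mod-3
  ... | inj₁ 3∣p+1 = inj₁ (lcm-least 2∣p+1 3∣p+1)
  ... | inj₂ 3∣m   = inj₂ (root-multiple {3} 2 (cube-root 3∣m))
  divides-or-root (inj₂ (inj₂ refl)) with p±1-mod-4 | p±1-mod-3
  ... | inj₁ 4∣p+1 | inj₁ 3∣p+1 = inj₁ (lcm-least 4∣p+1 3∣p+1)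
  ... | inj₂ 4∣m   | _          = inj₂ (root-multiple {4} 3 (fourth-root 4∣m))
  ... | inj₁ _     | inj₂ 3∣m   = inj₂ (root-multiple {3} 4 (cube-root 3∣m))

-- p ≤ 2.4 n gives p < 3n.
below-3n : ∀ {n p} → 0 < n → 5 * p ≤ 12 * n → p < 3 * n
below-3n {n} {p} 0<n 5p≤12n = *-cancelˡ-< 5 p (3 * n) (begin-strict
  5 * p         ≤⟨ 5p≤12n ⟩
  12 * n        <⟨ *-monoˡ-< n {{>-nonZero 0<n}} (m≤m+n 13 2) ⟩
  15 * n        ≡⟨ *-assoc 5 3 n ⟩
  5 * (3 * n)   ∎)
  where open ≤-Reasoning

even : ∀ {d} → d ≡ 4 ⊎ d ≡ 6 ⊎ d ≡ 12 → 2 ∣ d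
even (inj₁ refl)        = divides 2 refl
even (inj₂ (inj₁ refl)) = divides 3 refl
even (inj₂ (inj₂ refl)) = divides 6 refl

lemma4p2 : (n p d : ℕ) → .{{_ : NonZero p}} → 2 < n → Prime p → 3 < p →
           2 * n ∸ 1 ≤ p → 5 * p ≤ 12 * n →
           (d ≡ 4 ⊎ d ≡ 6 ⊎ d ≡ 12) →
           PairwiseDistinctMod n d p ⇔ (d ∣ p + 1)
lemma4p2 n (suc m) d 2<n p-prime 3<p 2n-1≤p 5p≤12n d∈ = mk⇔ only-if (distinct-if-divides n d 2n-1≤p)
  where
  open PrimeAbove3 m p-prime 3<p
  only-if : PairwiseDistinctMod n d p → d ∣ p + 1
  only-if distinct with divides-or-root d∈
  ... | inj₁ d∣p+1                   = d∣p+1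
  ... | inj₂ (ζ , p∤ζ , ζᵈ≈1 , ζ²≉1) = contradiction distinct
          (Collision.no-distinct-powers (even d∈) p∤ζ ζᵈ≈1 ζ²≉1 n 2n-1≤p (below-3n (<-trans z<s 2<n) 5p≤12n))
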